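{- Let $M$ be a matroid and $\mathcal{C}$ a circuit signature of $M$ that has the strong circuit elimination property (CE). Then there exists a unique cocircuit signature $\mathcal{C}^*$ of $M$ such that every element of $\mathcal{C}$ is orthogonal to every element of $\mathcal{C}^*$ (i.e. the pair $\mathcal{C},\mathcal{C}^*$ provides an orthogonal orientation of $M$).
   Context: Matroids are in the sense of Bruhn, Diestel, Kriesell, Pendavingh and Wollan (possibly infinite ground set); cocircuits are circuits of the dual $M^*$. A signed subset $X$ of $E$ is a support $\underline{X}\subseteq E$ with a partition $(X^+,X^-)$; $X(e)=\pm1$ according as $e\in X^\pm$; $-X$ swaps the parts. The separator is $\mathrm{sep}(X,Y)=(X^+\cap Y^-)\cup(X^-\cap Y^+)$. $X,Y$ are orthogonal if $\underline{X}\cap\underline{Y}=\emptyset$ or there are $e,f\in\underline{X}\cap\underline{Y}$ with $X(e)Y(e)=-X(f)Y(f)$. A circuit signature of $M$ is a set of signed subsets consisting of exactly two opposite signed subsets supported by each circuit of $M$; a cocircuit signature is a circuit signature of $M^*$. A circuit signature $\mathcal{C}$ has the strong circuit elimination property (CE) if: whenever $C\in\mathcal{C}$, $X\subseteq\underline{C}$ and $(C_x\mid x\in X)$ is a family of elements of $\mathcal{C}$ with $\underline{C_x}\cap X=\{x\}$ and $x\in\mathrm{sep}(C,C_x)$ for all $x\in X$, then for every $f\in\underline{C}\setminus\bigcup_{x\in X}\mathrm{sep}(C,C_x)$ there is $D\in\mathcal{C}$ with $f\in\underline{D}$, $D^+\subseteq (C^+\cup\bigcup_{x\in X}C_x^+)\setminus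 X$ and $D^-\subseteq (C^-\cup\bigcup_{x\in X}C_x^-)\setminus X$. -}

module Defs where

open import Level using (Level; 0ℓ) renaming (suc to lsuc)
open import Data.Product using (Σ; ∃; ∃-syntax; _×_; _,_)
open import Data.Sum using (_⊎_)
open import Data.Empty using (⊥)
open import Relation.Nullary using (¬_)
open import Relation.Binary.PropositionalEquality using (_≡_)

Subset : Set → Set₁
Subset E = E → Set

module _ {E : Set} where

  ∅ : Subset E
  ∅ _ = ⊥

  _⊆_ : Subset E → Subset E → Set
  A ⊆ B = ∀ e → A e → B e

  _≐_ : Subset E → Subset E → Set
  A ≐ B = (A ⊆ B) × (B ⊆ A)

  _∪_ : Subset E → Subset E → Subset E
  (A ∪ B) e = A e ⊎ B e

  _∩_ : Subset E → Subset E → Subset E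
  (A ∩ B) e = A e × B e

  _∖_ : Subset E → Subset E → Subset E
  (A ∖ B) e = A e × ¬ B e

  ｛_｝ : E → Subset E
  ｛ x ｝ e = e ≡ x

  Maximal : (Subset E → Set) → Subset E → Set₁
  Maximal P I = P I × (∀ J → P J → I ⊆ J → J ⊆ I)

  Minimal : (Subset E → Set) → Subset E → Set₁
  Minimal P C = P C × (∀ D → P D → D ⊆ C → C ⊆ D)

-- (Possibly infinite) matroids, via the independence axioms of
-- Bruhn–Diestel–Kriesell–Pendavingh–Wollan.

record Matroid (E : Set) : Set₁ where
  field
    Ind : Subset E → Set
    I1 : Ind ∅
    I2 : ∀ I J → J ⊆ I → Ind I → Ind J
    I3 : ∀ I I' → Ind I → ¬ Maximal Ind I → Maximal Ind I' →
         ∃[ x ] ((I' ∖ I) x × Ind (I ∪ ｛ x ｝))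
    IM : ∀ I X → Ind I → I ⊆ X →
         ∃[ J ] Maximal (λ I' → Ind I' × I ⊆ I' × I' ⊆ X) J

module _ {E : Set} (M : Matroid E) where
  open Matroid M

  Base : Subset E → Set₁
  Base B = Maximal Ind B

  Circuit : Subset E → Set₁
  Circuit = Minimal (λ C → ¬ Ind C)

  -- The dual M* has as bases the complements E ∖ B of bases B of M;
  -- its independent sets are the subsets of its bases, i.e. the sets
  -- disjoint from some base of M.
  IndDual : Subset E → Set₁
  IndDual X = ∃[ B ] (Base B × (∀ e → X e → ¬ B e))

  Cocircuit : Subset E → Set₁
  Cocircuit C = (¬ IndDual C) × (∀ D → ¬ IndDual D → D ⊆ C → C ⊆ D)

record Signed (E : Set) : Set₁ where
  field
    pos : Subset E
    neg : Subset E
    disjoint : ∀ e → pos e → neg e → ⊥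
open Signed public

module _ {E : Set} where

  supp : Signed E → Subset E
  supp X = pos X ∪ neg X

  negate : Signed E → Signed E
  negate X = record { pos = neg X ; neg = pos X
                    ; disjoint = λ e p n → disjoint X e n p }

  _≈ˢ_ : Signed E → Signed E → Set
  X ≈ˢ Y = (pos X ≐ pos Y) × (neg X ≐ neg Y)

  sep : Signed E → Signed E → Subset E
  sep X Y = (pos X ∩ neg Y) ∪ (neg X ∩ pos Y)

  agree : Signed E → Signed E → Subset E
  agree X Y = (pos X ∩ pos Y) ∪ (neg X ∩ neg Y)

  -- X,Y orthogonal: supports disjoint, or there are e,f in both
  -- supports with X(e)Y(e) = -X(f)Y(f)  (i.e. one of them has product +1
  -- and the other -1).
  Orthogonal : Signed E → Signed E → Set
  Orthogonal X Y =
    (∀ e → supp X e → supp Y e → ⊥) ⊎ (∃[ e ] ∃[ f ] (agree X Y e × sep X Y f))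

-- A set 𝒞 of signed subsets consists of exactly two opposite signed
-- subsets supported by each set satisfying `Circ` (sets of signed subsets
-- are predicates, compared up to extensional equality ≈ˢ).
IsSignatureFor : ∀ {E : Set} {ℓ : Level} → (Subset E → Set ℓ) →
                 (Signed E → Set) → Set (lsuc 0ℓ Level.⊔ ℓ)
IsSignatureFor {E} Circ 𝒞 =
    (∀ X → 𝒞 X → Circ (supp X))
  × (∀ C → Circ C → ∃[ X ] (𝒞 X × (supp X ≐ C)))
  × (∀ X → 𝒞 X → 𝒞 (negate X))
  × (∀ X Y → 𝒞 X → 𝒞 Y → supp X ≐ supp Y → (X ≈ˢ Y) ⊎ (X ≈ˢ negate Y))

CircuitSignature : ∀ {E} → Matroid E → (Signed E → Set) → Set₁
CircuitSignature M = IsSignatureFor (Circuit M)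

CocircuitSignature : ∀ {E} → Matroid E → (Signed E → Set) → Set₁
CocircuitSignature M = IsSignatureFor (Cocircuit M)

StrongCircuitElimination : ∀ {E : Set} → (Signed E → Set) → Set₁
StrongCircuitElimination {E} 𝒞 =
  ∀ (C : Signed E) (X : Subset E) (Cx : E → Signed E) →
    𝒞 C → X ⊆ supp C →
    (∀ x → X x → 𝒞 (Cx x)) →
    (∀ x → X x → (supp (Cx x) ∩ X) ≐ ｛ x ｝) →
    (∀ x → X x → sep C (Cx x) x) →
    ∀ f → supp C f → (∀ x → X x → ¬ sep C (Cx x) f) →
    ∃[ D ] ( 𝒞 D × supp D f
           × (pos D ⊆ ((pos C ∪ (λ e → ∃[ x ] (X x × pos (Cx x) e))) ∖ X))
           × (neg D ⊆ ((neg C ∪ (λ e → ∃[ x ] (X x × neg (Cx x) e))) ∖ X)) )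

{-# OPTIONS --safe #-}
module Submission where

-- Fix a cocircuit D, an element e ∈ D and a base B meeting D only in e. For x ∈ D − e the
-- fundamental circuit of x with respect to B meets D exactly in {e, x}, so orthogonality to
-- its signings fixes the sign of x relative to e: a signing of D orthogonal to 𝒞 is unique
-- up to sign, and there is exactly one candidate Y with Y(e) = +.
-- If a signed circuit X were not orthogonal to Y, then X or −X agrees with Y on all of
-- supp X ∩ D. Pick f there and use (CE) at f to eliminate the other elements of
-- supp X ∩ D − e against the signed fundamental circuits: the result still agrees with Y
-- and meets D inside {e, f}. A circuit never meets a cocircuit in a single element, so it
-- contains e, and eliminating once more at e leaves a circuit meeting D only in e.

open import Defs
open import Level using (Level)
open import Data.Product using (∃; ∃-syntax; _×_; _,_; proj₁; proj₂)
open import Axiom.ExcludedMiddle using (ExcludedMiddle)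
open import Data.Sum using (_⊎_; inj₁; inj₂; [_,_]′; swap; reduce)
open import Data.Empty using (⊥; ⊥-elim)
open import Data.Unit using (⊤; tt)
open import Function using (id)
open import Relation.Nullary using (¬_; yes; no)
open import Relation.Nullary.Decidable using (True; toWitness; fromWitness; decidable-stable)
open import Relation.Binary.PropositionalEquality using (_≡_; refl; sym; trans; subst)

module _ {E : Set} where

  ≐-sym : ∀ {A B : Subset E} → A ≐ B → B ≐ A
  ≐-sym (A⊆B , B⊆A) = B⊆A , A⊆B

  ≈ˢ-refl : ∀ {X : Signed E} → X ≈ˢ X
  ≈ˢ-refl = ((λ _ → id) , (λ _ → id)) , ((λ _ → id) , (λ _ → id))

  ∅ˢ : Signed E
  ∅ˢ = record { pos = ∅ ; neg = ∅ ; disjoint = λ _ () }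

  Agrees : Signed E → Signed E → Set
  Agrees X Y = ∀ h → supp X h → supp Y h → agree X Y h

  module _ {X Y : Signed E} {h : E} where

    agree⇒suppˡ : agree X Y h → supp X h
    agree⇒suppˡ (inj₁ (p , _)) = inj₁ p
    agree⇒suppˡ (inj₂ (n , _)) = inj₂ n

    agree⇒suppʳ : agree X Y h → supp Y h
    agree⇒suppʳ (inj₁ (_ , p)) = inj₁ p
    agree⇒suppʳ (inj₂ (_ , n)) = inj₂ n

    sep⇒suppʳ : sep X Y h → supp Y h
    sep⇒suppʳ (inj₁ (_ , n)) = inj₂ n
    sep⇒suppʳ (inj₂ (_ , p)) = inj₁ p

    agree-or-sep : supp X h → supp Y h → agree X Y h ⊎ sep X Y h
    agree-or-sep (inj₁ p) (inj₁ q) = inj₁ (inj₁ (p , q))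
    agree-or-sep (inj₁ p) (inj₂ q) = inj₂ (inj₁ (p , q))
    agree-or-sep (inj₂ n) (inj₁ q) = inj₂ (inj₂ (n , q))
    agree-or-sep (inj₂ n) (inj₂ q) = inj₁ (inj₂ (n , q))

    agree⇒¬sep : agree X Y h → ¬ sep X Y h
    agree⇒¬sep (inj₁ (p , _)) (inj₂ (n , _)) = disjoint X h p n
    agree⇒¬sep (inj₂ (n , _)) (inj₁ (p , _)) = disjoint X h p n
    agree⇒¬sep (inj₁ (_ , p)) (inj₁ (_ , n)) = disjoint Y h p n
    agree⇒¬sep (inj₂ (_ , n)) (inj₂ (_ , p)) = disjoint Y h p n

    agree-sym : agree X Y h → agree Y X h
    agree-sym (inj₁ (p , q)) = inj₁ (q , p)
    agree-sym (inj₂ (n , m)) = inj₂ (m , n)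

    sep-sym : sep X Y h → sep Y X h
    sep-sym (inj₁ (p , n)) = inj₂ (n , p)
    sep-sym (inj₂ (n , p)) = inj₁ (p , n)

    sep⇒agree-negateˡ : sep X Y h → agree (negate X) Y h
    sep⇒agree-negateˡ = swap

  agree-trans : ∀ {X Y Z : Signed E} {h} → agree X Y h → agree Y Z h → agree X Z h
  agree-trans     (inj₁ (p , _)) (inj₁ (_ , q)) = inj₁ (p , q)
  agree-trans     (inj₂ (n , _)) (inj₂ (_ , m)) = inj₂ (n , m)
  agree-trans {Y = Y} (inj₁ (_ , p)) (inj₂ (n , _)) = ⊥-elim (disjoint Y _ p n)
  agree-trans {Y = Y} (inj₂ (_ , n)) (inj₁ (p , _)) = ⊥-elim (disjoint Y _ p n)

  -- sep Y Z is agree Y (negate Z) on the nose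
  agree-sep-trans : ∀ {X Y Z : Signed E} {h} → agree X Y h → sep Y Z h → sep X Z h
  agree-sep-trans {X} {Y} {Z} = agree-trans {X} {Y} {negate Z}

  sep-sep-trans : ∀ {X Y Z : Signed E} {h} → sep X Y h → sep Y Z h → agree X Z h
  sep-sep-trans     (inj₁ (p , _)) (inj₂ (_ , q)) = inj₁ (p , q)
  sep-sep-trans     (inj₂ (n , _)) (inj₁ (_ , m)) = inj₂ (n , m)
  sep-sep-trans {Y = Y} (inj₁ (_ , n)) (inj₁ (p , _)) = ⊥-elim (disjoint Y _ p n)
  sep-sep-trans {Y = Y} (inj₂ (_ , p)) (inj₂ (n , _)) = ⊥-elim (disjoint Y _ p n)

  Orthogonal-negateʳ : ∀ {X Y : Signed E} → Orthogonal X Y → Orthogonal X (negate Y)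
  Orthogonal-negateʳ (inj₁ disj) = inj₁ (λ h Xh Yh → disj h Xh (swap Yh))
  Orthogonal-negateʳ (inj₂ (a , s , agr , sp)) = inj₂ (s , a , sp , agr)

  orthogonal-at-pair : ∀ {X Y : Signed E} {e g} → Orthogonal X Y →
    (∀ h → supp X h → supp Y h → h ≡ e ⊎ h ≡ g) → agree X Y e → sep X Y g
  orthogonal-at-pair {X} {Y} (inj₁ disj) _ agr-e =
    ⊥-elim (disj _ (agree⇒suppˡ {X} {Y} agr-e) (agree⇒suppʳ {X} {Y} agr-e))
  orthogonal-at-pair {X} {Y} (inj₂ (_ , s , _ , sp)) common agr-e
    with common s (swap (agree⇒suppˡ {negate X} {Y} (sep⇒agree-negateˡ {X} {Y} sp)))
                  (sep⇒suppʳ {X} {Y} sp)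
  ... | inj₁ refl = ⊥-elim (agree⇒¬sep {X} {Y} agr-e sp)
  ... | inj₂ refl = sp

  -- X·Y₁ and X·Y₂ both change sign between e and g, hence Y₁·Y₂ does not.
  orthogonal-pair-transfer : ∀ {X Y₁ Y₂ : Signed E} {e g} → Orthogonal X Y₁ → Orthogonal X Y₂ →
    (∀ h → supp X h → supp Y₁ h → h ≡ e ⊎ h ≡ g) → (∀ h → supp X h → supp Y₂ h → h ≡ e ⊎ h ≡ g) →
    agree X Y₁ e → agree Y₁ Y₂ e → agree Y₁ Y₂ g
  orthogonal-pair-transfer {X} {Y₁} {Y₂} ⊥₁ ⊥₂ common₁ common₂ agr₁ agr₁₂ =
    sep-sep-trans {Y₁} {X} {Y₂} (sep-sym {X} {Y₁} (orthogonal-at-pair {X} {Y₁} ⊥₁ common₁ agr₁))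
      (orthogonal-at-pair {X} {Y₂} ⊥₂ common₂ (agree-trans {X} {Y₁} {Y₂} agr₁ agr₁₂))

  ¬Orthogonal⇒Agrees± : ∀ {X Y : Signed E} {f} → ¬ Orthogonal X Y → supp X f → supp Y f →
    Agrees X Y ⊎ Agrees (negate X) Y
  ¬Orthogonal⇒Agrees± {X} {Y} ¬XY Xf Yf with agree-or-sep {X} {Y} Xf Yf
  ... | inj₁ agr-f = inj₁ λ h Xh Yh →
    [ id , (λ sp → ⊥-elim (¬XY (inj₂ (_ , h , agr-f , sp)))) ]′ (agree-or-sep {X} {Y} Xh Yh)
  ... | inj₂ sep-f = inj₂ λ h -Xh Yh →
    [ (λ agr → ⊥-elim (¬XY (inj₂ (h , _ , agr , sep-f)))) , sep⇒agree-negateˡ {X} {Y} ]′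
      (agree-or-sep {X} {Y} (swap -Xh) Yh)

  agrees⇒≈ˢ : ∀ {X Y : Signed E} → supp Y ⊆ supp X → (∀ h → supp X h → agree X Y h) → X ≈ˢ Y
  agrees⇒≈ˢ {X} {Y} Y⊆X agr =
    ((λ h p → pos-pos {X} {Y} (agr h (inj₁ p)) p) ,
     (λ h q → pos-pos {Y} {X} (agree-sym {X} {Y} (agr h (Y⊆X h (inj₁ q)))) q)) ,
    ((λ h n → neg-neg {X} {Y} (agr h (inj₂ n)) n) ,
     (λ h m → neg-neg {Y} {X} (agree-sym {X} {Y} (agr h (Y⊆X h (inj₂ m)))) m))
    where
      pos-pos : ∀ {A B : Signed E} {h} → agree A B h → pos A h → pos B h
      pos-pos (inj₁ (_ , q)) _ = q
      pos-pos {A} (inj₂ (n , _)) p = ⊥-elim (disjoint A _ p n)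
      neg-neg : ∀ {A B : Signed E} {h} → agree A B h → neg A h → neg B h
      neg-neg (inj₂ (_ , m)) _ = m
      neg-neg {A} (inj₁ (p , _)) n = ⊥-elim (disjoint A _ p n)

  inherits-sign : ∀ {D C : Signed E} {X : Subset E} {Cx : E → Signed E} →
    pos D ⊆ ((pos C ∪ (λ h → ∃[ x ] (X x × pos (Cx x) h))) ∖ X) →
    neg D ⊆ ((neg C ∪ (λ h → ∃[ x ] (X x × neg (Cx x) h))) ∖ X) →
    ∀ {h} → supp D h → ¬ X h × (agree D C h ⊎ ∃[ x ] (X x × agree D (Cx x) h))
  inherits-sign pos⊆ neg⊆ {h} (inj₁ p) with pos⊆ h p
  ... | inj₁ q , h∉X = h∉X , inj₁ (inj₁ (p , q))
  ... | inj₂ (x , Xx , q) , h∉X = h∉X , inj₂ (x , Xx , inj₁ (p , q))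
  inherits-sign pos⊆ neg⊆ {h} (inj₂ n) with neg⊆ h n
  ... | inj₁ m , h∉X = h∉X , inj₁ (inj₂ (n , m))
  ... | inj₂ (x , Xx , m) , h∉X = h∉X , inj₂ (x , Xx , inj₂ (n , m))

drop-from-minimal : ∀ {ℓ} {E : Set} {P : Subset E → Set ℓ} {C : Subset E} {e : E} →
  (∀ D → P D → D ⊆ C → C ⊆ D) → C e → ¬ P (C ∖ ｛ e ｝)
drop-from-minimal minimal Ce P-C∖e = proj₂ (minimal _ P-C∖e (λ _ → proj₁) _ Ce) refl

module _ (lem : ∀ {ℓ} → ExcludedMiddle ℓ) where

  stable : ∀ {ℓ} {P : Set ℓ} → ¬ ¬ P → P
  stable = decidable-stable lem

  -- Hilbert's ε: a witness of P if there is one, x₀ otherwise.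
  ε : ∀ {a} {A : Set a} → A → (A → Set) → A
  ε x₀ P with lem {P = ∃ P}
  ... | yes (x , _) = x
  ... | no _ = x₀

  ε-spec : ∀ {a} {A : Set a} (x₀ : A) (P : A → Set) → ∃ P → P (ε x₀ P)
  ε-spec x₀ P ∃P with lem {P = ∃ P}
  ... | yes (_ , Px) = Px
  ... | no ¬∃P = ⊥-elim (¬∃P ∃P)

  module _ {E : Set} (M : Matroid E) where
    open Matroid M

    MaximalBetween : Subset E → Subset E → Subset E → Set₁
    MaximalBetween I X = Maximal (λ J → Ind J × I ⊆ J × J ⊆ X)

    base-exists : ∃[ B ] Base M B
    base-exists with IM ∅ (λ _ → ⊤) I1 (λ _ ())
    ... | B , (indB , _) , maximal =
      B , indB , λ J indJ B⊆J → maximal J (indJ , (λ _ ()) , (λ _ _ → tt)) B⊆J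

    cocircuit-nonempty : ∀ {D} → Cocircuit M D → ∃[ e ] D e
    cocircuit-nonempty (dependent , _) with base-exists
    ... | B , bB = stable λ D≡∅ → dependent (B , bB , λ e De _ → D≡∅ (e , De))

    Cocircuit-resp-≐ : ∀ {C C'} → C ≐ C' → Cocircuit M C → Cocircuit M C'
    Cocircuit-resp-≐ (C⊆C' , C'⊆C) (dependent , minimal) =
      (λ { (B , bB , disj) → dependent (B , bB , λ e Ce → disj e (C⊆C' e Ce)) }) ,
      λ D dep D⊆C' h C'h → minimal D dep (λ h Dh → C'⊆C h (D⊆C' h Dh)) h (C'⊆C h C'h)

    base∩cocircuit⊆singleton : ∀ {D e} → Cocircuit M D → D e →
      ∃[ B ] (Base M B × (∀ h → B h → D h → h ≡ e))
    base∩cocircuit⊆singleton (_ , minimal) De with stable (drop-from-minimal minimal De)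
    ... | B , bB , disj = B , bB , λ h Bh Dh → stable λ h≢e → disj h (Dh , h≢e) Bh

    augment-outside : ∀ {B I X J} → Base M B → MaximalBetween I X J → ¬ Base M J →
      ∃[ x ] (B x × ¬ X x × Ind (J ∪ ｛ x ｝))
    augment-outside {B} {I} {X} {J} bB ((indJ , I⊆J , J⊆X) , maximal) ¬bJ
      with I3 J B indJ ¬bJ bB
    ... | x , (Bx , x∉J) , indJx = x , Bx , x∉X , indJx
      where
        x∉X : ¬ X x
        x∉X Xx = x∉J (maximal (J ∪ ｛ x ｝)
          (indJx , (λ h Ih → inj₁ (I⊆J h Ih)) , (λ h → [ J⊆X h , (λ { refl → Xx }) ]′))
          (λ _ → inj₁) x (inj₂ refl))

    maximal-above-base-is-base : ∀ {B I X J} → Base M B → B ⊆ X → MaximalBetween I X J → Base M J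
    maximal-above-base-is-base bB B⊆X maxJ = stable λ ¬bJ →
      let (y , By , y∉X , _) = augment-outside bB maxJ ¬bJ in y∉X (B⊆X y By)

    -- Extend C − e to a maximal independent J avoiding D. J is not a base, and B (meeting D
    -- only in e) can augment it only by e; but then C ⊆ J + e would be independent.
    circuit∩cocircuit≢singleton : ∀ {C D e} → Circuit M C → Cocircuit M D → C e → D e →
      ¬ (∀ h → C h → D h → h ≡ e)
    circuit∩cocircuit≢singleton {C} {D} {e} (dependent , minimal) cD Ce De C∩D⊆e
      with base∩cocircuit⊆singleton cD De
         | IM (C ∖ ｛ e ｝) (λ h → ¬ D h) (stable (drop-from-minimal minimal Ce))
              (λ h (Ch , h≢e) Dh → h≢e (C∩D⊆e h Ch Dh))
    ... | B , bB , B∩D⊆e | J , maxJ@((_ , C∖e⊆J , J∩D≡∅) , _)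
      with augment-outside bB maxJ (λ bJ → proj₁ cD (J , bJ , λ h Dh Jh → J∩D≡∅ h Jh Dh))
    ... | x , Bx , ¬¬Dx , indJx = dependent (I2 _ C C⊆J∪x indJx)
      where
        x≡e : x ≡ e
        x≡e = B∩D⊆e x Bx (stable ¬¬Dx)
        C⊆J∪x : C ⊆ (J ∪ ｛ x ｝)
        C⊆J∪x h Ch with lem {P = h ≡ e}
        ... | yes h≡e = inj₂ (trans h≡e (sym x≡e))
        ... | no h≢e = inj₁ (C∖e⊆J h (Ch , h≢e))

    FundamentalCircuit : Subset E → E → Subset E
    FundamentalCircuit B x h = h ≡ x ⊎ (B h × Ind ((B ∪ ｛ x ｝) ∖ ｛ h ｝))

    fundamental⊆ : ∀ {B x} → FundamentalCircuit B x ⊆ (B ∪ ｛ x ｝)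
    fundamental⊆ h (inj₁ h≡x) = inj₂ h≡x
    fundamental⊆ h (inj₂ (Bh , _)) = inj₁ Bh

    base∪-dependent : ∀ {B x} → Base M B → ¬ B x → ¬ Ind (B ∪ ｛ x ｝)
    base∪-dependent (_ , maximal) x∉B ind = x∉B (maximal _ ind (λ _ → inj₁) _ (inj₂ refl))

    -- Otherwise F extends to a base J ⊆ B + x. For b ∈ B − J, the only element of J that
    -- B − b can be augmented by is x, so B + x − b is independent, i.e. b ∈ F ⊆ J.
    fundamental-dependent : ∀ {B x} → Base M B → ¬ B x → ¬ Ind (FundamentalCircuit B x)
    fundamental-dependent {B} {x} bB x∉B indF
      with IM (FundamentalCircuit B x) (B ∪ ｛ x ｝) indF fundamental⊆
    ... | J , maxJ@((indJ , F⊆J , J⊆B∪x) , _)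
      with stable {P = ∃[ b ] ((B ∪ ｛ x ｝) b × ¬ J b)} (λ none →
             base∪-dependent bB x∉B (I2 J _ (λ h h∈ → stable λ h∉J → none (h , h∈ , h∉J)) indJ))
    ... | b , inj₂ refl , b∉J = b∉J (F⊆J b (inj₁ refl))
    ... | b , inj₁ Bb , b∉J = b∉J (F⊆J b (inj₂ (Bb , exchange)))
      where
        B∖b-not-base : ¬ Base M (B ∖ ｛ b ｝)
        B∖b-not-base (_ , maximal) = proj₂ (maximal B (proj₁ bB) (λ _ → proj₁) b Bb) refl
        exchange : Ind ((B ∪ ｛ x ｝) ∖ ｛ b ｝)
        exchange with I3 (B ∖ ｛ b ｝) J (I2 B _ (λ _ → proj₁) (proj₁ bB)) B∖b-not-base
                         (maximal-above-base-is-base bB (λ _ → inj₁) maxJ)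
        ... | y , (Jy , y∉B∖b) , ind with J⊆B∪x y Jy
        ... | inj₂ refl =
          I2 _ _ (λ { h (inj₁ Bh , h≢b) → inj₁ (Bh , h≢b) ; h (inj₂ h≡x , _) → inj₂ h≡x }) ind
        ... | inj₁ By = ⊥-elim (b∉J (subst J (stable λ y≢b → y∉B∖b (By , y≢b)) Jy))

    fundamental-minimal : ∀ {B x} → Base M B → ∀ C → ¬ Ind C → C ⊆ FundamentalCircuit B x →
      FundamentalCircuit B x ⊆ C
    fundamental-minimal {B} {x} bB C dep C⊆F h Fh = stable λ h∉C → dep (independent h∉C Fh)
      where
        independent : ¬ C h → FundamentalCircuit B x h → Ind C
        independent h∉C (inj₁ refl) = I2 B C C⊆B (proj₁ bB)
          where
            C⊆B : C ⊆ B
            C⊆B c Cc = [ (λ { refl → ⊥-elim (h∉C Cc) }) , proj₁ ]′ (C⊆F c Cc)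
        independent h∉C (inj₂ (_ , ind)) =
          I2 _ C (λ c Cc → fundamental⊆ c (C⊆F c Cc) , λ { refl → h∉C Cc }) ind

    fundamental-circuit : ∀ {B x} → Base M B → ¬ B x → Circuit M (FundamentalCircuit B x)
    fundamental-circuit bB x∉B = fundamental-dependent bB x∉B , fundamental-minimal bB

    abstract
      circuit-through-pair : ∀ {D e x} → Cocircuit M D → D e → D x → ¬ x ≡ e →
        ∃[ C ] (Circuit M C × C e × C x × (∀ h → C h → D h → h ≡ e ⊎ h ≡ x))
      circuit-through-pair {D} {e} {x} cD De Dx x≢e with base∩cocircuit⊆singleton cD De
      ... | B , bB , B∩D⊆e = F , cF , Fe , inj₁ refl , F∩D⊆
        where
          F : Subset E
          F = FundamentalCircuit B x
          cF : Circuit M F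
          cF = fundamental-circuit bB (λ Bx → x≢e (B∩D⊆e x Bx Dx))
          F∩D⊆ : ∀ h → F h → D h → h ≡ e ⊎ h ≡ x
          F∩D⊆ h (inj₁ h≡x) _ = inj₂ h≡x
          F∩D⊆ h (inj₂ (Bh , _)) Dh = inj₁ (B∩D⊆e h Bh Dh)
          Fe : F e
          Fe = stable λ e∉F → circuit∩cocircuit≢singleton cF cD (inj₁ refl) Dx
            λ h Fh Dh → [ (λ { refl → ⊥-elim (e∉F Fh) }) , id ]′ (F∩D⊆ h Fh Dh)

  module Cosignatures {E : Set} (M : Matroid E) (𝒞 : Signed E → Set) (sig : CircuitSignature M 𝒞) where

    private
      𝒞-circuit : ∀ X → 𝒞 X → Circuit M (supp X)
      𝒞-circuit = proj₁ sig
      𝒞-signs : ∀ C → Circuit M C → ∃[ X ] (𝒞 X × (supp X ≐ C))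
      𝒞-signs = proj₁ (proj₂ sig)
      𝒞-negate : ∀ X → 𝒞 X → 𝒞 (negate X)
      𝒞-negate = proj₁ (proj₂ (proj₂ sig))

    Orthogonal-to-𝒞 : Signed E → Set₁
    Orthogonal-to-𝒞 Y = ∀ X → 𝒞 X → Orthogonal X Y

    abstract
      signed-circuit-through-pair : ∀ {D e x} → Cocircuit M D → D e → D x → ¬ x ≡ e →
        ∃[ X ] (𝒞 X × pos X e × supp X x × (∀ h → supp X h → D h → h ≡ e ⊎ h ≡ x))
      signed-circuit-through-pair cD De Dx x≢e =
        let (C , cC , Ce , Cx , C∩D⊆) = circuit-through-pair M cD De Dx x≢e
            (X , 𝒞X , X⊆C , C⊆X) = 𝒞-signs C cC
        in [ (λ e⁺ → X , 𝒞X , e⁺ , C⊆X _ Cx , λ h Xh → C∩D⊆ h (X⊆C h Xh))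
           , (λ e⁻ → negate X , 𝒞-negate X 𝒞X , e⁻ , swap (C⊆X _ Cx) ,
                     λ h -Xh → C∩D⊆ h (X⊆C h (swap -Xh))) ]′
             (C⊆X _ Ce)

    orthogonal-cosignings-agree : ∀ {Y₁ Y₂ e} → Cocircuit M (supp Y₁) → supp Y₂ ⊆ supp Y₁ →
      Orthogonal-to-𝒞 Y₁ → Orthogonal-to-𝒞 Y₂ → agree Y₁ Y₂ e → ∀ g → supp Y₁ g → agree Y₁ Y₂ g
    orthogonal-cosignings-agree {Y₁} {Y₂} {e} cD Y₂⊆Y₁ ⊥Y₁ ⊥Y₂ agr-e g Y₁g with lem {P = g ≡ e}
    ... | yes refl = agr-e
    ... | no g≢e =
      let (X , 𝒞X , Xe , _ , X∩D⊆) = signed-circuit-through-pair cD Y₁e Y₁g g≢e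
      in [ transfer X 𝒞X X∩D⊆
         , (λ sp → transfer (negate X) (𝒞-negate X 𝒞X) (λ h -Xh → X∩D⊆ h (swap -Xh))
                             (sep⇒agree-negateˡ {X = X} {Y = Y₁} sp)) ]′
           (agree-or-sep {X = X} {Y = Y₁} (inj₁ Xe) Y₁e)
      where
        Y₁e : supp Y₁ e
        Y₁e = agree⇒suppˡ {X = Y₁} {Y = Y₂} agr-e
        transfer : ∀ X → 𝒞 X → (∀ h → supp X h → supp Y₁ h → h ≡ e ⊎ h ≡ g) →
                   agree X Y₁ e → agree Y₁ Y₂ g
        transfer X 𝒞X X∩D⊆ agr = orthogonal-pair-transfer {X = X} {Y₁} {Y₂} (⊥Y₁ X 𝒞X) (⊥Y₂ X 𝒞X)
          X∩D⊆ (λ h Xh Y₂h → X∩D⊆ h Xh (Y₂⊆Y₁ h Y₂h)) agr agr-e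

    orthogonal-cosignings-coincide : ∀ {Y₁ Y₂} → Cocircuit M (supp Y₁) → supp Y₁ ≐ supp Y₂ →
      Orthogonal-to-𝒞 Y₁ → Orthogonal-to-𝒞 Y₂ → Y₁ ≈ˢ Y₂ ⊎ Y₁ ≈ˢ negate Y₂
    orthogonal-cosignings-coincide {Y₁} {Y₂} cD (Y₁⊆Y₂ , Y₂⊆Y₁) ⊥Y₁ ⊥Y₂ with cocircuit-nonempty M cD
    ... | e , Y₁e with agree-or-sep {X = Y₁} {Y = Y₂} Y₁e (Y₁⊆Y₂ e Y₁e)
    ... | inj₁ agr = inj₁ (agrees⇒≈ˢ {X = Y₁} {Y = Y₂} Y₂⊆Y₁
                            (orthogonal-cosignings-agree {Y₁} {Y₂} cD Y₂⊆Y₁ ⊥Y₁ ⊥Y₂ agr))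
    ... | inj₂ sp = inj₂ (agrees⇒≈ˢ {X = Y₁} {Y = negate Y₂} -Y₂⊆Y₁
                            (orthogonal-cosignings-agree {Y₁} {negate Y₂} cD -Y₂⊆Y₁ ⊥Y₁ ⊥-Y₂ sp))
      where
        -Y₂⊆Y₁ : supp (negate Y₂) ⊆ supp Y₁
        -Y₂⊆Y₁ h -Y₂h = Y₂⊆Y₁ h (swap -Y₂h)
        ⊥-Y₂ : Orthogonal-to-𝒞 (negate Y₂)
        ⊥-Y₂ X 𝒞X = Orthogonal-negateʳ {X = X} {Y = Y₂} (⊥Y₂ X 𝒞X)

    module Existence (ce : StrongCircuitElimination 𝒞)
                     {D : Subset E} (cD : Cocircuit M D) {e : E} (De : D e) where

      FundamentalSigning : E → Signed E → Set
      FundamentalSigning x X = 𝒞 X × pos X e × supp X x × (∀ h → supp X h → D h → h ≡ e ⊎ h ≡ x)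

      S : E → Signed E
      S x = ε ∅ˢ (FundamentalSigning x)

      abstract
        S-spec : ∀ {x} → D x → ¬ x ≡ e → FundamentalSigning x (S x)
        S-spec Dx x≢e = ε-spec ∅ˢ (FundamentalSigning _) (signed-circuit-through-pair cD De Dx x≢e)

      S-signed : ∀ {x} → D x → ¬ x ≡ e → 𝒞 (S x)
      S-signed Dx x≢e = proj₁ (S-spec Dx x≢e)

      S-positive-at-e : ∀ {x} → D x → ¬ x ≡ e → pos (S x) e
      S-positive-at-e Dx x≢e = proj₁ (proj₂ (S-spec Dx x≢e))

      S-through-x : ∀ {x} → D x → ¬ x ≡ e → supp (S x) x
      S-through-x Dx x≢e = proj₁ (proj₂ (proj₂ (S-spec Dx x≢e)))

      S∩D⊆ : ∀ {x} → D x → ¬ x ≡ e → ∀ h → supp (S x) h → D h → h ≡ e ⊎ h ≡ x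
      S∩D⊆ Dx x≢e = proj₂ (proj₂ (proj₂ (S-spec Dx x≢e)))

      -- The only signing of D with Y(e) = + that is orthogonal to every S x.
      Y : Signed E
      Y = record
        { pos = λ x → x ≡ e ⊎ (D x × ¬ x ≡ e × neg (S x) x)
        ; neg = λ x → D x × ¬ x ≡ e × pos (S x) x
        ; disjoint = λ where
            x (inj₁ x≡e) (_ , x≢e , _) → x≢e x≡e
            x (inj₂ (_ , _ , n)) (_ , _ , p) → disjoint (S x) x p n }

      suppY⊆D : supp Y ⊆ D
      suppY⊆D _ (inj₁ (inj₁ refl)) = De
      suppY⊆D _ (inj₁ (inj₂ (Dx , _))) = Dx
      suppY⊆D _ (inj₂ (Dx , _)) = Dx

      Y-separates-S : ∀ {x} → D x → ¬ x ≡ e → sep Y (S x) x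
      Y-separates-S Dx x≢e with S-through-x Dx x≢e
      ... | inj₁ p = inj₂ ((Dx , x≢e , p) , p)
      ... | inj₂ n = inj₁ (inj₂ (Dx , x≢e , n) , n)

      D⊆suppY : D ⊆ supp Y
      D⊆suppY x Dx with lem {P = x ≡ e}
      ... | yes x≡e = inj₁ (inj₁ x≡e)
      ... | no x≢e = agree⇒suppˡ {X = Y} {Y = negate (S x)} (Y-separates-S Dx x≢e)

      module Elimination {X : Signed E} {f : E}
                         (𝒞X : 𝒞 X) (X~Y : Agrees X Y) (Xf : supp X f) (Df : D f) where

        Eliminated : Subset E
        Eliminated x = supp X x × D x × ¬ x ≡ e × ¬ x ≡ f

        outside-Eliminated : ∀ {h} → supp X h → D h → ¬ Eliminated h → h ≡ e ⊎ h ≡ f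
        outside-Eliminated Xh Dh h∉I = stable λ h≢e,f →
          h∉I (Xh , Dh , (λ h≡e → h≢e,f (inj₁ h≡e)) , (λ h≡f → h≢e,f (inj₂ h≡f)))

        S∩D-outside-Eliminated : ∀ {x h} → Eliminated x → supp (S x) h → D h → ¬ Eliminated h → h ≡ e
        S∩D-outside-Eliminated Ix@(_ , Dx , x≢e , _) Sxh Dh h∉I with S∩D⊆ Dx x≢e _ Sxh Dh
        ... | inj₁ h≡e = h≡e
        ... | inj₂ refl = ⊥-elim (h∉I Ix)

        S-agrees-Y-outside-Eliminated : ∀ {x h} → Eliminated x → supp (S x) h → D h → ¬ Eliminated h → agree (S x) Y h
        S-agrees-Y-outside-Eliminated Ix@(_ , Dx , x≢e , _) Sxh Dh h∉I with S∩D-outside-Eliminated Ix Sxh Dh h∉I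
        ... | refl = inj₁ (S-positive-at-e Dx x≢e , inj₁ refl)

        S∩Eliminated : ∀ x → Eliminated x → (supp (S x) ∩ Eliminated) ≐ ｛ x ｝
        S∩Eliminated x Ix@(_ , Dx , x≢e , _) =
          (λ h (Sxh , (_ , Dh , h≢e , _)) → [ (λ h≡e → ⊥-elim (h≢e h≡e)) , id ]′ (S∩D⊆ Dx x≢e h Sxh Dh)) ,
          λ { _ refl → S-through-x Dx x≢e , Ix }

        X-separates-S : ∀ x → Eliminated x → sep X (S x) x
        X-separates-S x (Xx , Dx , x≢e , _) =
          agree-sep-trans {X = X} {Y} {S x} (X~Y x Xx (D⊆suppY x Dx)) (Y-separates-S Dx x≢e)

        f-not-separated : ∀ x → Eliminated x → ¬ sep X (S x) f
        f-not-separated x Ix sp = agree⇒¬sep {X = X} {Y = S x}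
          (agree-trans {X = X} {Y} {S x} (X~Y f Xf (D⊆suppY f Df))
            (agree-sym {X = S x} {Y = Y}
              (S-agrees-Y-outside-Eliminated Ix (sep⇒suppʳ {X = X} {Y = S x} sp) Df f∉Eliminated)))
          sp
          where
            f∉Eliminated : ¬ Eliminated f
            f∉Eliminated (_ , _ , _ , f≢f) = f≢f refl

        eliminate : ∃[ X' ] (𝒞 X' × supp X' f × Agrees X' Y × (∀ h → supp X' h → D h → h ≡ e ⊎ h ≡ f))
        eliminate with ce X Eliminated S 𝒞X (λ _ → proj₁) (λ _ (_ , Dx , x≢e , _) → S-signed Dx x≢e)
                          S∩Eliminated X-separates-S f Xf f-not-separated
        ... | X' , 𝒞X' , X'f , pos⊆ , neg⊆ =
          X' , 𝒞X' , X'f , (λ h X'h Yh → proj₂ (traced X'h (suppY⊆D h Yh))) ,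
          (λ h X'h Dh → proj₁ (traced X'h Dh))
          where
            traced : ∀ {h} → supp X' h → D h → (h ≡ e ⊎ h ≡ f) × agree X' Y h
            traced {h} X'h Dh with inherits-sign {D = X'} {C = X} {Eliminated} {S} pos⊆ neg⊆ X'h
            ... | h∉I , inj₁ X'~X =
              outside-Eliminated Xh Dh h∉I , agree-trans {X = X'} {X} {Y} X'~X (X~Y h Xh (D⊆suppY h Dh))
              where
                Xh = agree⇒suppʳ {X = X'} {Y = X} X'~X
            ... | h∉I , inj₂ (x , Ix , X'~Sx) =
              inj₁ (S∩D-outside-Eliminated Ix Sxh Dh h∉I) ,
              agree-trans {X = X'} {S x} {Y} X'~Sx (S-agrees-Y-outside-Eliminated Ix Sxh Dh h∉I)
              where
                Sxh = agree⇒suppʳ {X = X'} {Y = S x} X'~Sx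

      open Elimination using (eliminate)

      no-agreeing-circuit-through-e : ∀ {X} → 𝒞 X → Agrees X Y → ¬ supp X e
      no-agreeing-circuit-through-e 𝒞X X~Y Xe with eliminate 𝒞X X~Y Xe De
      ... | X' , 𝒞X' , X'e , _ , X'∩D⊆ =
        circuit∩cocircuit≢singleton M (𝒞-circuit X' 𝒞X') cD X'e De λ h X'h Dh → reduce (X'∩D⊆ h X'h Dh)

      no-agreeing-circuit : ∀ {X f} → 𝒞 X → Agrees X Y → supp X f → ¬ D f
      no-agreeing-circuit 𝒞X X~Y Xf Df with eliminate 𝒞X X~Y Xf Df
      ... | X' , 𝒞X' , X'f , X'~Y , X'∩D⊆ with lem {P = supp X' e}
      ... | yes X'e = no-agreeing-circuit-through-e 𝒞X' X'~Y X'e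
      ... | no X'∌e = circuit∩cocircuit≢singleton M (𝒞-circuit X' 𝒞X') cD X'f Df λ h X'h Dh →
              [ (λ { refl → ⊥-elim (X'∌e X'h) }) , id ]′ (X'∩D⊆ h X'h Dh)

      Y-orthogonal : Orthogonal-to-𝒞 Y
      Y-orthogonal X 𝒞X = stable λ X⊥̸Y →
        let (f , Xf , Yf) = stable {P = ∃[ f ] (supp X f × supp Y f)} λ none →
                              X⊥̸Y (inj₁ λ f Xf Yf → none (f , Xf , Yf))
        in [ (λ X~Y → no-agreeing-circuit 𝒞X X~Y Xf (suppY⊆D f Yf))
           , (λ -X~Y → no-agreeing-circuit (𝒞-negate X 𝒞X) -X~Y (swap Xf) (suppY⊆D f Yf)) ]′
             (¬Orthogonal⇒Agrees± {X = X} {Y = Y} X⊥̸Y Xf Yf)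

    orthogonal-cosigning-exists : StrongCircuitElimination 𝒞 → ∀ {D} → Cocircuit M D →
      ∃[ Y ] (supp Y ≐ D × Orthogonal-to-𝒞 Y)
    orthogonal-cosigning-exists ce cD =
      let (e , De) = cocircuit-nonempty M cD
          open Existence ce cD De
      in Y , (suppY⊆D , D⊆suppY) , Y-orthogonal

    OrthogonalCosigning : Signed E → Set₁
    OrthogonalCosigning Y = Cocircuit M (supp Y) × Orthogonal-to-𝒞 Y

    -- The predicate lives in Set₁; deciding it by excluded middle brings 𝒞* down to Set.
    𝒞* : Signed E → Set
    𝒞* Y = True (lem {P = OrthogonalCosigning Y})

    𝒞*-cocircuit-signature : StrongCircuitElimination 𝒞 → CocircuitSignature M 𝒞*
    𝒞*-cocircuit-signature ce = (λ Y 𝒞*Y → proj₁ (toWitness 𝒞*Y)) , signing , negate-closed , coincide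
      where
        signing : ∀ D → Cocircuit M D → ∃[ Y ] (𝒞* Y × (supp Y ≐ D))
        signing D cD =
          let (Y , Y≐D , ⊥Y) = orthogonal-cosigning-exists ce cD
          in Y , fromWitness (Cocircuit-resp-≐ M (≐-sym Y≐D) cD , ⊥Y) , Y≐D
        negate-closed : ∀ Y → 𝒞* Y → 𝒞* (negate Y)
        negate-closed Y 𝒞*Y =
          let (cY , ⊥Y) = toWitness 𝒞*Y
          in fromWitness (Cocircuit-resp-≐ M ((λ _ → swap) , (λ _ → swap)) cY ,
                          λ X 𝒞X → Orthogonal-negateʳ {X = X} {Y = Y} (⊥Y X 𝒞X))
        coincide : ∀ Y₁ Y₂ → 𝒞* Y₁ → 𝒞* Y₂ → supp Y₁ ≐ supp Y₂ → Y₁ ≈ˢ Y₂ ⊎ Y₁ ≈ˢ negate Y₂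
        coincide Y₁ Y₂ 𝒞*Y₁ 𝒞*Y₂ Y₁≐Y₂ =
          let (cY₁ , ⊥Y₁) = toWitness 𝒞*Y₁
          in orthogonal-cosignings-coincide {Y₁} {Y₂} cY₁ Y₁≐Y₂ ⊥Y₁ (proj₂ (toWitness 𝒞*Y₂))

    𝒞*-orthogonal : ∀ X Y → 𝒞 X → 𝒞* Y → Orthogonal X Y
    𝒞*-orthogonal X Y 𝒞X 𝒞*Y = proj₂ (toWitness 𝒞*Y) X 𝒞X

    𝒞*-unique : ∀ 𝒟 → CocircuitSignature M 𝒟 → (∀ X Y → 𝒞 X → 𝒟 Y → Orthogonal X Y) →
      (∀ Y → 𝒟 Y → ∃[ Z ] (𝒞* Z × (Y ≈ˢ Z))) × (∀ Z → 𝒞* Z → ∃[ Y ] (𝒟 Y × (Z ≈ˢ Y)))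
    𝒞*-unique 𝒟 (𝒟-cocircuit , 𝒟-signs , 𝒟-negate , _) 𝒞⊥𝒟 = 𝒟⊆𝒞* , 𝒞*⊆±𝒟
      where
        𝒟⊆𝒞* : ∀ Y → 𝒟 Y → ∃[ Z ] (𝒞* Z × (Y ≈ˢ Z))
        𝒟⊆𝒞* Y 𝒟Y = Y , fromWitness (𝒟-cocircuit Y 𝒟Y , λ X 𝒞X → 𝒞⊥𝒟 X Y 𝒞X 𝒟Y) , ≈ˢ-refl {X = Y}
        𝒞*⊆±𝒟 : ∀ Z → 𝒞* Z → ∃[ Y ] (𝒟 Y × (Z ≈ˢ Y))
        𝒞*⊆±𝒟 Z 𝒞*Z =
          let (cZ , ⊥Z) = toWitness 𝒞*Z
              (Y , 𝒟Y , Y≐Z) = 𝒟-signs (supp Z) cZ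
          in [ (λ Z≈Y → Y , 𝒟Y , Z≈Y) , (λ Z≈-Y → negate Y , 𝒟-negate Y 𝒟Y , Z≈-Y) ]′
               (orthogonal-cosignings-coincide {Z} {Y} cZ (≐-sym Y≐Z) ⊥Z (λ X 𝒞X → 𝒞⊥𝒟 X Y 𝒞X 𝒟Y))

proposition4p2 : (lem : ∀ {ℓ : Level} → ExcludedMiddle ℓ) →
    {E : Set} (M : Matroid E) (𝒞 : Signed E → Set) →
    CircuitSignature M 𝒞 → StrongCircuitElimination 𝒞 →
    ∃[ 𝒞* ] ( CocircuitSignature M 𝒞*
            × (∀ X Y → 𝒞 X → 𝒞* Y → Orthogonal X Y)
            × (∀ 𝒟 → CocircuitSignature M 𝒟 →
                 (∀ X Y → 𝒞 X → 𝒟 Y → Orthogonal X Y) →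
                 (∀ Y → 𝒟 Y → ∃[ Z ] (𝒞* Z × (Y ≈ˢ Z)))
               × (∀ Z → 𝒞* Z → ∃[ Y ] (𝒟 Y × (Z ≈ˢ Y)))) )
proposition4p2 lem M 𝒞 sig ce = 𝒞* , 𝒞*-cocircuit-signature ce , 𝒞*-orthogonal , 𝒞*-unique
  where open Cosignatures lem M 𝒞 sig
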